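{- For every integer $m\ge 1$, the graph $K_{1,2}\times P_{2m+2}$ is antimagic.
   Context: $K_{1,s}$ denotes the star with one center and $s$ leaves, and $P_n$ denotes the path on $n$ vertices. For graphs $G$ and $H$, the direct product $G\times H$ has vertex set $V(G)\times V(H)$, with $(x,y)$ adjacent to $(x',y')$ if and only if $xx'\in E(G)$ and $yy'\in E(H)$. A (possibly disconnected) graph $G$ is antimagic if there is a bijection $f:E(G)\to\{1,2,\dots,|E(G)|\}$ such that the vertex sums $\sum_{e\ni v} f(e)$ are pairwise distinct over all vertices $v$ of $G$. -}

module Defs where

open import Data.Nat using (ℕ; zero; suc; _+_; _*_; _<ᵇ_; _≡ᵇ_)
open import Data.Bool using (Bool; true; false; _∧_; _∨_; T)
open import Data.Fin using (Fin; toℕ; remQuot; combine; _≟_)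
open import Data.Product using (_×_; _,_; proj₁; proj₂)
open import Data.List using (List; length; filterᵇ; cartesianProduct; allFin; lookup; map)
open import Data.Nat.ListAction using (sum)
open import Relation.Nullary using (does)
open import Function.Bundles using (_⤖_; Bijection)
open import Function.Definitions using (Injective)
open import Relation.Binary.PropositionalEquality using (_≡_; refl; cong₂)

record Graph : Set where
  field
    order : ℕ
    adj   : Fin order → Fin order → Bool
    sym   : ∀ i j → adj i j ≡ adj j i
    irr   : ∀ i → adj i i ≡ false
open Graph public

edges : (G : Graph) → List (Fin (order G) × Fin (order G))
edges G = filterᵇ (λ p → (toℕ (proj₁ p) <ᵇ toℕ (proj₂ p)) ∧ adj G (proj₁ p) (proj₂ p))
                  (cartesianProduct (allFin (order G)) (allFin (order G)))

size : Graph → ℕ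
size G = length (edges G)

incident : (G : Graph) → Fin (order G) → Fin (size G) → Bool
incident G v k = does (v ≟ proj₁ e) ∨ does (v ≟ proj₂ e)
  where e = lookup (edges G) k

-- A labeling is a bijection from edge indices to Fin |E|; edge k gets
-- label toℕ (f k) + 1, so the labels are exactly {1,…,|E|}.
Labeling : Graph → Set
Labeling G = Fin (size G) ⤖ Fin (size G)

label : (G : Graph) → Labeling G → Fin (size G) → ℕ
label G f k = suc (toℕ (Bijection.to f k))

vertexSum : (G : Graph) → Labeling G → Fin (order G) → ℕ
vertexSum G f v = sum (map (label G f) (filterᵇ (incident G v) (allFin (size G))))

Antimagic : Graph → Set
Antimagic G = Data.Product.Σ (Labeling G) λ f → Injective _≡_ _≡_ (vertexSum G f)

-- Direct (tensor) product; vertex (x , y) is encoded as combine x y,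
-- decoded by remQuot.
module _ (G H : Graph) where
  private
    dec : Fin (order G * order H) → Fin (order G) × Fin (order H)
    dec = remQuot {order G} (order H)
    padj : Fin (order G * order H) → Fin (order G * order H) → Bool
    padj a b = adj G (proj₁ (dec a)) (proj₁ (dec b)) ∧ adj H (proj₂ (dec a)) (proj₂ (dec b))
    psym : ∀ a b → padj a b ≡ padj b a
    psym a b = cong₂ _∧_ (sym G (proj₁ (dec a)) (proj₁ (dec b))) (sym H (proj₂ (dec a)) (proj₂ (dec b)))
    pirr : ∀ a → padj a a ≡ false
    pirr a rewrite irr G (proj₁ (dec a)) = refl
  directProduct : Graph
  directProduct = record { order = order G * order H ; adj = padj ; sym = psym ; irr = pirr }

-- Star K_{1,s}: vertex 0 is the center, vertices 1..s are leaves.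
star : ℕ → Graph
star s = record
  { order = suc s
  ; adj = λ i j → ((toℕ i ≡ᵇ 0) ∧ (0 <ᵇ toℕ j)) ∨ ((toℕ j ≡ᵇ 0) ∧ (0 <ᵇ toℕ i))
  ; sym = λ i j → Data.Bool.Properties.∨-comm ((toℕ i ≡ᵇ 0) ∧ (0 <ᵇ toℕ j)) ((toℕ j ≡ᵇ 0) ∧ (0 <ᵇ toℕ i))
  ; irr = irrS
  }
  where
  import Data.Bool.Properties
  irrS : (i : Fin (suc s)) → _
  irrS Fin.zero = Relation.Binary.PropositionalEquality.refl
  irrS (Fin.suc i) = Relation.Binary.PropositionalEquality.refl
  import Relation.Binary.PropositionalEquality

path : ℕ → Graph
path n = record
  { order = n
  ; adj = λ i j → (suc (toℕ i) ≡ᵇ toℕ j) ∨ (suc (toℕ j) ≡ᵇ toℕ i)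
  ; sym = λ i j → Data.Bool.Properties.∨-comm (suc (toℕ i) ≡ᵇ toℕ j) (suc (toℕ j) ≡ᵇ toℕ i)
  ; irr = λ i → irrP (toℕ i)
  }
  where
  import Data.Bool.Properties
  open import Relation.Binary.PropositionalEquality using (refl)
  irrP : (k : ℕ) → ((suc k ≡ᵇ k) ∨ (suc k ≡ᵇ k)) ≡ false
  irrP zero = refl
  irrP (suc k) = irrP k

{-# OPTIONS --safe #-}
module Submission where

-- Write the vertices of K₁,₂ × P_{p+2} as pairs (x , y) of a star vertex x (0 is the centre) and a
-- path vertex y, and list the 4p + 4 edges by their endpoint in column 0: two at (0 , 0), four at
-- each (0 , j + 1) with j < p, two at (0 , p + 1).  Label the k-th edge (counting from 0) by k + 1,
-- then exchange the labels of the edges 2 and 6 and of the edges 4p + 1 and 4p + 3.  A vertex lies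
-- in at most two consecutive blocks, so its sum is an explicit linear expression in p.  For
-- p = 2h ≥ 4 the sums fall into sixteen families that are told apart by the quotient and remainder
-- of the sum on division by 8, so an explicit decoder recovers every vertex from its sum; for p = 2
-- the twelve sums are computed.

open import Defs hiding (sym)
open import Data.Bool using (Bool; true; false; _∧_; _∨_; T; if_then_else_)
open import Data.Bool.Properties using (∧-zeroʳ; ∨-identityʳ; T-∧; T-∨)
open import Data.Empty using (⊥-elim)
open import Data.Fin as Fin using (Fin; toℕ; zero; suc; remQuot; combine; fromℕ<; _↑ˡ_; _↑ʳ_)
import Data.Fin.Permutation.Components as PC
open import Data.Fin.Permutation using (transpose; _∘ₚ_)
open import Data.Fin.Properties using (remQuot-combine; combine-remQuot; toℕ-combine; toℕ-injective; toℕ<n; toℕ-fromℕ<; all?)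
open import Data.List
  using (List; []; _∷_; _++_; [_]; map; concat; concatMap; length; filter; filterᵇ; tabulate; allFin; lookup; cartesianProduct)
open import Data.List.Properties
  using (map-++; ++-identityʳ; map-tabulate; tabulate-cong; filter-++; filter-none; filter-accept; filter-reject; filter-≐;
         concat-++; length-++; length-map; concatMap-map)
open import Data.List.Relation.Unary.All using (All; []; _∷_; universal)
import Data.List.Relation.Unary.All as All
open import Data.List.Relation.Unary.All.Properties using (map⁺; ++⁺; all-filter)
open import Data.Nat using (ℕ; zero; suc; _+_; _*_; _≤_; _<_; _≡ᵇ_; _<ᵇ_; _≤ᵇ_; _%_; _/_; ⌊_/2⌋; z≤n; s≤s; z<s)
open import Data.Nat.DivMod using ([m+kn]%n≡m%n; m<n⇒m%n≡m; +-distrib-/-∣ʳ; m<n⇒m/n≡0; m*n/n≡m)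
open import Data.Nat.Divisibility using (n∣m*n)
open import Data.Nat.ListAction using (sum)
open import Data.Nat.Properties
  using (_≟_; _<?_; ≡ᵇ⇒≡; ≡⇒≡ᵇ; ≤ᵇ⇒≤; <ᵇ⇒<; <-cmp; ≤-refl; ≤-trans; ≤-antisym; <-trans; ≤-<-trans; <-≤-trans;
         <⇒≤; <-irrefl; ≤-pred; ≤∧≢⇒<; <⇒≢; >⇒≢; 1+n≢n; suc-injective; n≤1+n; n<1+n; m<n⇒m<1+n;
         m≤n⇒m<n∨m≡n; m≤n⇒∃[o]m+o≡n; m<m+n; m≤m+n; m≤n+m; m≤m*n;
         +-identityʳ; +-suc; +-assoc; +-comm; *-comm; *-suc; *-zeroʳ;
         +-mono-≤; +-monoʳ-≤; +-monoʳ-<; *-monoʳ-≤; *-monoʳ-<; n≡⌊n+n/2⌋; module ≤-Reasoning)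
open import Data.Nat.Tactic.RingSolver using (solve-∀)
open import Data.Product using (_×_; _,_; proj₁; proj₂)
open import Data.Sum using (_⊎_; inj₁; inj₂) renaming ([_,_] to either)
open import Data.Unit using (tt)
open import Function using (_∘_; Equivalence)
open import Function.Definitions using (Injective)
open import Function.Properties.Inverse using (↔⇒⤖)
open import Relation.Binary using (tri<; tri≈; tri>)
open import Relation.Binary.PropositionalEquality hiding ([_])
open import Relation.Nullary using (¬_; Dec; yes; no; does)
open import Relation.Nullary.Decidable using (dec-true; dec-false; T?; toWitness; _→-dec_)

≡ᵇ-refl : ∀ n → (n ≡ᵇ n) ≡ true
≡ᵇ-refl n = dec-true (n ≟ n) refl

≢⇒≡ᵇ≡false : ∀ {m n} → m ≢ n → (m ≡ᵇ n) ≡ false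
≢⇒≡ᵇ≡false {m} {n} = dec-false (m ≟ n)

<⇒<ᵇ≡true : ∀ {m n} → m < n → (m <ᵇ n) ≡ true
<⇒<ᵇ≡true {m} {n} = dec-true (m <? n)

≮⇒<ᵇ≡false : ∀ {m n} → ¬ m < n → (m <ᵇ n) ≡ false
≮⇒<ᵇ≡false {m} {n} = dec-false (m <? n)

n<2+n : ∀ n → n < suc (suc n)
n<2+n n = <-trans (n<1+n n) (n<1+n (suc n))

n≡ᵇ2+n : ∀ n → (n ≡ᵇ suc (suc n)) ≡ false
n≡ᵇ2+n n = ≢⇒≡ᵇ≡false (<⇒≢ (n<2+n n))

2+n≡ᵇn : ∀ n → (suc (suc n) ≡ᵇ n) ≡ false
2+n≡ᵇn n = ≢⇒≡ᵇ≡false (<⇒≢ (n<2+n n) ∘ sym)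

range : ℕ → ℕ → List ℕ
range a zero = []
range a (suc l) = a ∷ range (suc a) l

range-++ : ∀ a l₁ l₂ → range a (l₁ + l₂) ≡ range a l₁ ++ range (a + l₁) l₂
range-++ a zero l₂ = cong (λ b → range b l₂) (sym (+-identityʳ a))
range-++ a (suc l₁) l₂ =
  cong (a ∷_) (trans (range-++ (suc a) l₁ l₂) (cong (λ b → range (suc a) l₁ ++ range b l₂) (sym (+-suc a l₁))))

range-∷ʳ : ∀ a l → range a (suc l) ≡ range a l ++ [ a + l ]
range-∷ʳ a l = trans (cong (range a) (+-comm 1 l)) (range-++ a l 1)

range-bounded : ∀ a l → All (λ t → a ≤ t × t < a + l) (range a l)
range-bounded a zero = []
range-bounded a (suc l) =
  (≤-refl , m<m+n a z<s) ∷ All.map (λ {t} (a<t , t<) → <⇒≤ a<t , subst (t <_) (sym (+-suc a l)) t<) (range-bounded (suc a) l)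

tabulate-toℕ : ∀ {A : Set} (g : ℕ → A) a l → tabulate {n = l} (λ i → g (a + toℕ i)) ≡ map g (range a l)
tabulate-toℕ g a zero = refl
tabulate-toℕ g a (suc l) =
  cong₂ _∷_ (cong g (+-identityʳ a)) (trans (tabulate-cong (λ i → cong g (+-suc a (toℕ i)))) (tabulate-toℕ g (suc a) l))

tabulate-+ : ∀ {A : Set} m n (f : Fin (m + n) → A) → tabulate f ≡ tabulate (f ∘ (_↑ˡ n)) ++ tabulate (f ∘ (m ↑ʳ_))
tabulate-+ zero n f = refl
tabulate-+ (suc m) n f = cong (f zero ∷_) (tabulate-+ m n (f ∘ suc))

tabulate-combine : ∀ {A : Set} m n (f : Fin (m * n) → A) →
  tabulate f ≡ concat (tabulate {n = m} (λ x → tabulate {n = n} (λ y → f (combine x y))))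
tabulate-combine zero n f = refl
tabulate-combine (suc m) n f =
  trans (tabulate-+ n (m * n) f) (cong (tabulate (f ∘ (_↑ˡ m * n)) ++_) (tabulate-combine m n (f ∘ (n ↑ʳ_))))

filterᵇ-cong : ∀ {A : Set} {p q : A → Bool} → (∀ x → p x ≡ q x) → ∀ xs → filterᵇ p xs ≡ filterᵇ q xs
filterᵇ-cong {p = p} {q} e = filter-≐ (T? ∘ p) (T? ∘ q) ((λ {x} → subst T (e x)) , (λ {x} → subst T (sym (e x))))

filterᵇ-none : ∀ {A : Set} {p : A → Bool} {xs} → All (λ x → p x ≡ false) xs → filterᵇ p xs ≡ []
filterᵇ-none {p = p} = filter-none (T? ∘ p) ∘ All.map (subst T)

filterᵇ-map : ∀ {A B : Set} (p : B → Bool) (f : A → B) xs → filterᵇ p (map f xs) ≡ map f (filterᵇ (p ∘ f) xs)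
filterᵇ-map p f [] = refl
filterᵇ-map p f (x ∷ xs) with p (f x)
... | true = cong (f x ∷_) (filterᵇ-map p f xs)
... | false = filterᵇ-map p f xs

filterᵇ-cartesianProduct : ∀ {A B : Set} (p : A × B → Bool) xs ys →
  filterᵇ p (cartesianProduct xs ys) ≡ concatMap (λ x → filterᵇ p (map (x ,_) ys)) xs
filterᵇ-cartesianProduct p [] ys = refl
filterᵇ-cartesianProduct p (x ∷ xs) ys = trans (filter-++ _ (map (x ,_) ys) _) (cong (_ ++_) (filterᵇ-cartesianProduct p xs ys))

map-cartesianProduct : ∀ {A B : Set} (f : A → B) xs ys →
  map (λ (x , y) → f x , f y) (cartesianProduct xs ys) ≡ cartesianProduct (map f xs) (map f ys)
map-cartesianProduct f [] ys = refl
map-cartesianProduct f (x ∷ xs) ys = trans (map-++ _ (map (x ,_) ys) _) (cong₂ _++_ (row ys) (map-cartesianProduct f xs ys))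
  where
  row : ∀ ys → map (λ (x , y) → f x , f y) (map (x ,_) ys) ≡ map (f x ,_) (map f ys)
  row [] = refl
  row (y ∷ ys) = cong (_ ∷_) (row ys)

concatMap-++ : ∀ {A B : Set} (f : A → List B) xs ys → concatMap f (xs ++ ys) ≡ concatMap f xs ++ concatMap f ys
concatMap-++ f xs ys = trans (cong concat (map-++ f xs ys)) (sym (concat-++ (map f xs) (map f ys)))

concatMap-congᴬ : ∀ {A B : Set} {f g : A → List B} {xs} → All (λ x → f x ≡ g x) xs → concatMap f xs ≡ concatMap g xs
concatMap-congᴬ [] = refl
concatMap-congᴬ (e ∷ es) = cong₂ _++_ e (concatMap-congᴬ es)

concatMap-[] : ∀ {A B : Set} {f : A → List B} → (∀ x → f x ≡ []) → ∀ xs → concatMap f xs ≡ []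
concatMap-[] e [] = refl
concatMap-[] e (x ∷ xs) = cong₂ _++_ (e x) (concatMap-[] e xs)

indexedSum : ∀ {A : Set} → (A → ℕ → ℕ) → List A → ℕ → ℕ
indexedSum H [] o = 0
indexedSum H (x ∷ xs) o = H x o + indexedSum H xs (suc o)

sum-map-filterᵇ-tabulate : ∀ {A : Set} {l} (g : Fin l → A) (R : A → Bool) (W : A → ℕ) →
  sum (map W (filterᵇ R (tabulate g))) ≡ sum (tabulate (λ i → if R (g i) then W (g i) else 0))
sum-map-filterᵇ-tabulate {l = zero} g R W = refl
sum-map-filterᵇ-tabulate {l = suc l} g R W with R (g zero)
... | true = cong (W (g zero) +_) (sum-map-filterᵇ-tabulate (g ∘ suc) R W)
... | false = sum-map-filterᵇ-tabulate (g ∘ suc) R W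

sum-tabulate-lookup : ∀ {A : Set} (H : A → ℕ → ℕ) xs o →
  sum (tabulate (λ k → H (lookup xs k) (o + toℕ k))) ≡ indexedSum H xs o
sum-tabulate-lookup H [] o = refl
sum-tabulate-lookup H (x ∷ xs) o = cong₂ _+_ (cong (H x) (+-identityʳ o))
  (trans (cong sum (tabulate-cong (λ k → cong (H (lookup xs k)) (+-suc o (toℕ k))))) (sum-tabulate-lookup H xs (suc o)))

indexedSum-map : ∀ {A B : Set} (H : B → ℕ → ℕ) (f : A → B) xs o → indexedSum H (map f xs) o ≡ indexedSum (H ∘ f) xs o
indexedSum-map H f [] o = refl
indexedSum-map H f (x ∷ xs) o = cong (H (f x) o +_) (indexedSum-map H f xs (suc o))

indexedSum-++ : ∀ {A : Set} (H : A → ℕ → ℕ) xs ys o →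
  indexedSum H (xs ++ ys) o ≡ indexedSum H xs o + indexedSum H ys (o + length xs)
indexedSum-++ H [] ys o = cong (indexedSum H ys) (sym (+-identityʳ o))
indexedSum-++ H (x ∷ xs) ys o rewrite indexedSum-++ H xs ys (suc o) | +-suc o (length xs) = sym (+-assoc (H x o) _ _)

indexedSum-zero : ∀ {A : Set} (H : A → ℕ → ℕ) {xs} o → All (λ x → ∀ k → H x k ≡ 0) xs → indexedSum H xs o ≡ 0
indexedSum-zero H o [] = refl
indexedSum-zero H o (e ∷ es) rewrite e o = indexedSum-zero H (suc o) es

sumBelow : ℕ → (ℕ → ℕ) → ℕ
sumBelow zero g = 0
sumBelow (suc r) g = sumBelow r g + g r

sumBelow-zero : ∀ r g → (∀ j → j < r → g j ≡ 0) → sumBelow r g ≡ 0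
sumBelow-zero zero g z = refl
sumBelow-zero (suc r) g z rewrite z r ≤-refl | sumBelow-zero r g (λ j j<r → z j (m<n⇒m<1+n j<r)) = refl

sumBelow-one : ∀ r a g → a < r → (∀ j → j < r → j ≢ a → g j ≡ 0) → sumBelow r g ≡ g a
sumBelow-one (suc r) a g a<r z with a ≟ r
... | yes refl = cong (_+ g a) (sumBelow-zero r g (λ j j<r → z j (m<n⇒m<1+n j<r) (λ { refl → <-irrefl refl j<r })))
... | no a≢r = trans (cong₂ _+_ (sumBelow-one r a g (≤∧≢⇒< (≤-pred a<r) a≢r) (λ j j<r → z j (m<n⇒m<1+n j<r)))
                                  (z r ≤-refl (a≢r ∘ sym))) (+-identityʳ _)

sumBelow-two : ∀ r a b g → a < b → b < r → (∀ j → j < r → j ≢ a → j ≢ b → g j ≡ 0) → sumBelow r g ≡ g a + g b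
sumBelow-two (suc r) a b g a<b b<r z with b ≟ r
... | yes refl = cong (_+ g b) (sumBelow-one r a g a<b (λ j j<r j≢a → z j (m<n⇒m<1+n j<r) j≢a (λ { refl → <-irrefl refl j<r })))
... | no b≢r = trans (cong₂ _+_ (sumBelow-two r a b g a<b b<r′ (λ j j<r → z j (m<n⇒m<1+n j<r)))
                                  (z r ≤-refl (λ { refl → <-irrefl refl (<-trans a<b b<r′) }) (b≢r ∘ sym))) (+-identityʳ _)
  where
  b<r′ : b < r
  b<r′ = ≤∧≢⇒< (≤-pred b<r) b≢r

-- Coordinates on K₁,₂ × Pₙ

Coord : Set
Coord = ℕ × ℕ

at : ℕ → ℕ → Coord
at x y = x , y

from : Coord → Coord → Coord × Coord
from u v = u , v

-- The adjacency of star 2 and path n, read on toℕ, so that isEdge-coord² holds by computation.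
starAdj : ℕ → ℕ → Bool
starAdj x x′ = ((x ≡ᵇ 0) ∧ (0 <ᵇ x′)) ∨ ((x′ ≡ᵇ 0) ∧ (0 <ᵇ x))

pathAdj : ℕ → ℕ → Bool
pathAdj y y′ = (suc y ≡ᵇ y′) ∨ (suc y′ ≡ᵇ y)

T-pathAdj : ∀ {y t} → T (pathAdj y t) → suc y ≡ t ⊎ suc t ≡ y
T-pathAdj {y} {t} adj with Equivalence.to T-∨ adj
... | inj₁ e = inj₁ (≡ᵇ⇒≡ (suc y) t e)
... | inj₂ e = inj₂ (≡ᵇ⇒≡ (suc t) y e)

pathAdj-suc : ∀ y → T (pathAdj y (suc y))
pathAdj-suc y = Equivalence.from T-∨ (inj₁ (≡⇒≡ᵇ (suc y) (suc y) refl))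

pathAdj-pred : ∀ t → T (pathAdj (suc t) t)
pathAdj-pred t = Equivalence.from T-∨ (inj₂ (≡⇒≡ᵇ (suc t) (suc t) refl))

¬pathAdj : ∀ {y t} → suc y ≢ t → suc t ≢ y → ¬ T (pathAdj y t)
¬pathAdj n₁ n₂ = either n₁ n₂ ∘ T-pathAdj

filterᵇ-pathAdj-below : ∀ y a l → a + l < y → filterᵇ (pathAdj y) (range a l) ≡ []
filterᵇ-pathAdj-below y a l a+l<y = filter-none (T? ∘ pathAdj y) (All.map far (range-bounded a l))
  where
  far : ∀ {t} → a ≤ t × t < a + l → ¬ T (pathAdj y t)
  far {t} (_ , t<a+l) = ¬pathAdj {y} {t} (λ { refl → <-irrefl refl (<-trans (<-trans (n<1+n y) t<a+l) a+l<y) })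
                                         (λ { refl → <-irrefl refl (≤-<-trans t<a+l a+l<y) })

filterᵇ-pathAdj-above : ∀ y a l → suc y < a → filterᵇ (pathAdj y) (range a l) ≡ []
filterᵇ-pathAdj-above y a l y+1<a = filter-none (T? ∘ pathAdj y) (All.map far (range-bounded a l))
  where
  far : ∀ {t} → a ≤ t × t < a + l → ¬ T (pathAdj y t)
  far {t} (a≤t , _) = ¬pathAdj {y} {t} (λ { refl → <-irrefl refl (<-≤-trans y+1<a a≤t) })
                                       (λ { refl → <-irrefl refl (<-trans (n<1+n t) (<-trans (n<1+n _) (<-≤-trans y+1<a a≤t))) })

_≡ᶜ_ : Coord → Coord → Bool
(x , y) ≡ᶜ (x′ , y′) = (x ≡ᵇ x′) ∧ (y ≡ᵇ y′)

≡ᶜ-refl : ∀ u → (u ≡ᶜ u) ≡ true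
≡ᶜ-refl (x , y) rewrite ≡ᵇ-refl x | ≡ᵇ-refl y = refl

≡ᶜ⇒≡ : ∀ u v → T (u ≡ᶜ v) → u ≡ v
≡ᶜ⇒≡ (x , y) (x′ , y′) t = let (tx , ty) = Equivalence.to T-∧ t in
  cong₂ _,_ (≡ᵇ⇒≡ x x′ tx) (≡ᵇ⇒≡ y y′ ty)

incidentᶜ : Coord → Coord × Coord → Bool
incidentᶜ u (a , b) = (u ≡ᶜ a) ∨ (u ≡ᶜ b)

incidenceSum : (ℕ → ℕ) → Coord → List (Coord × Coord) → ℕ → ℕ
incidenceSum w u = indexedSum (λ e k → if incidentᶜ u e then w k else 0)

incidenceSum-zero : ∀ w u {es} o → All (λ e → incidentᶜ u e ≡ false) es → incidenceSum w u es o ≡ 0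
incidenceSum-zero w u o = indexedSum-zero _ o ∘ All.map (λ e _ → cong (if_then _ else 0) e)

module StarPath (n : ℕ) where

  G : Graph
  G = directProduct (star 2) (path n)

  coord : Fin (3 * n) → Coord
  coord i = toℕ (proj₁ (remQuot {3} n i)) , toℕ (proj₂ (remQuot {3} n i))

  coord-combine : ∀ x y → coord (combine x y) ≡ (toℕ x , toℕ y)
  coord-combine x y = cong (λ (x , y) → toℕ x , toℕ y) (remQuot-combine {3} x y)

  toℕ≡n*x+y : ∀ i → toℕ i ≡ n * proj₁ (coord i) + proj₂ (coord i)
  toℕ≡n*x+y i =
    trans (cong toℕ (sym (combine-remQuot {3} n i))) (toℕ-combine (proj₁ (remQuot {3} n i)) (proj₂ (remQuot {3} n i)))

  coord-injective : ∀ {i j} → coord i ≡ coord j → i ≡ j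
  coord-injective {i} {j} e = toℕ-injective (trans (toℕ≡n*x+y i) (trans (cong (λ (x , y) → n * x + y) e) (sym (toℕ≡n*x+y j))))

  coord² : Fin (3 * n) × Fin (3 * n) → Coord × Coord
  coord² (i , j) = coord i , coord j

  isEdge : Coord × Coord → Bool
  isEdge ((x , y) , (x′ , y′)) = (n * x + y <ᵇ n * x′ + y′) ∧ (starAdj x x′ ∧ pathAdj y y′)

  isEdge-coord² : ∀ ij → ((toℕ (proj₁ ij) <ᵇ toℕ (proj₂ ij)) ∧ adj G (proj₁ ij) (proj₂ ij)) ≡ isEdge (coord² ij)
  isEdge-coord² (i , j) rewrite toℕ≡n*x+y i | toℕ≡n*x+y j = refl

  row : ℕ → List Coord
  row x = map (at x) (range 0 n)

  vertices : List Coord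
  vertices = concatMap row (range 0 3)

  coord-allFin : map coord (allFin (3 * n)) ≡ vertices
  coord-allFin = begin
    map coord (allFin (3 * n))
      ≡⟨ map-tabulate (λ i → i) coord ⟩
    tabulate coord
      ≡⟨ tabulate-combine 3 n coord ⟩
    concat (tabulate {n = 3} (λ x → tabulate {n = n} (λ y → coord (combine x y))))
      ≡⟨ cong concat (tabulate-cong (λ x → trans (tabulate-cong (coord-combine x)) (tabulate-toℕ (at (toℕ x)) 0 n))) ⟩
    concat (tabulate {n = 3} (λ x → row (toℕ x)))
      ≡⟨ cong concat (tabulate-toℕ row 0 3) ⟩
    vertices ∎
    where open ≡-Reasoning

  neighbours : ℕ → List ℕ
  neighbours y = filterᵇ (pathAdj y) (range 0 n)

  block : ℕ → List (Coord × Coord)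
  block y = map (from (0 , y)) (map (at 1) (neighbours y) ++ map (at 2) (neighbours y))

  edgeList : List (Coord × Coord)
  edgeList = concatMap block (range 0 n)

  edgesFrom : Coord → List (Coord × Coord)
  edgesFrom u = filterᵇ isEdge (map (from u) vertices)

  targets : Coord → ℕ → List ℕ
  targets u x′ = filterᵇ (λ y′ → isEdge (u , (x′ , y′))) (range 0 n)

  edgesFrom-byRow : ∀ u → edgesFrom u ≡ map (from u) (concatMap (λ x′ → map (at x′) (targets u x′)) (range 0 3))
  edgesFrom-byRow u = trans (filterᵇ-map isEdge (from u) vertices) (cong (map (from u)) (byRow (range 0 3)))
    where
    byRow : ∀ xs → filterᵇ (isEdge ∘ from u) (concatMap row xs) ≡ concatMap (λ x′ → map (at x′) (targets u x′)) xs
    byRow [] = refl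
    byRow (x′ ∷ xs) =
      trans (filter-++ _ (row x′) _) (cong₂ _++_ (filterᵇ-map (isEdge ∘ from u) (at x′) (range 0 n)) (byRow xs))

  edgesFrom-centre : ∀ y → y < n → edgesFrom (0 , y) ≡ block y
  edgesFrom-centre y y<n =
    trans (edgesFrom-byRow (0 , y))
          (cong (map (from (0 , y))) (cong₂ _++_ no-centre (cong₂ _++_ (leaf 0) (trans (++-identityʳ _) (leaf 1)))))
    where
    no-centre : map (at 0) (targets (0 , y) 0) ≡ []
    no-centre = cong (map (at 0)) (filterᵇ-none (universal (λ t → ∧-zeroʳ _) (range 0 n)))
    before : ∀ c t → (n * 0 + y <ᵇ n * suc c + t) ≡ true
    before c t = <⇒<ᵇ≡true (begin-strict
      n * 0 + y     ≡⟨ cong (_+ y) (*-zeroʳ n) ⟩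
      y             <⟨ y<n ⟩
      n             ≤⟨ m≤m*n n (suc c) ⟩
      n * suc c     ≤⟨ m≤m+n _ t ⟩
      n * suc c + t ∎)
      where open ≤-Reasoning
    leaf : ∀ c → map (at (suc c)) (targets (0 , y) (suc c)) ≡ map (at (suc c)) (neighbours y)
    leaf c = cong (map (at (suc c))) (filterᵇ-cong (λ t → cong (_∧ pathAdj y t) (before c t)) (range 0 n))

  edgesFrom-leaf : ∀ c y → edgesFrom (suc c , y) ≡ []
  edgesFrom-leaf c y =
    trans (edgesFrom-byRow (suc c , y)) (cong (map _) (cong₂ _++_ to-centre (cong₂ _++_ (to-leaf 0) (cong (_++ []) (to-leaf 1)))))
    where
    after : ∀ t → t < n → (n * suc c + y <ᵇ n * 0 + t) ≡ false
    after t t<n = ≮⇒<ᵇ≡false (λ lt → <-irrefl refl (<-trans lt (begin-strict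
      n * 0 + t     ≡⟨ cong (_+ t) (*-zeroʳ n) ⟩
      t             <⟨ t<n ⟩
      n             ≤⟨ m≤m*n n (suc c) ⟩
      n * suc c     ≤⟨ m≤m+n _ y ⟩
      n * suc c + y ∎)))
      where open ≤-Reasoning
    to-centre : map (at 0) (targets (suc c , y) 0) ≡ []
    to-centre = cong (map (at 0))
      (filterᵇ-none (All.map (λ {t} (_ , t<n) → cong (_∧ (starAdj (suc c) 0 ∧ pathAdj y t)) (after t t<n)) (range-bounded 0 n)))
    to-leaf : ∀ d → map (at (suc d)) (targets (suc c , y) (suc d)) ≡ []
    to-leaf d = cong (map (at (suc d))) (filterᵇ-none (universal (λ t → ∧-zeroʳ _) (range 0 n)))

  coord-edges : map coord² (edges G) ≡ edgeList
  coord-edges = begin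
    map coord² (edges G)
      ≡⟨ cong (map coord²) (filterᵇ-cong isEdge-coord² pairs) ⟩
    map coord² (filterᵇ (isEdge ∘ coord²) pairs)
      ≡⟨ sym (filterᵇ-map isEdge coord² pairs) ⟩
    filterᵇ isEdge (map coord² pairs)
      ≡⟨ cong (filterᵇ isEdge) (map-cartesianProduct coord (allFin (3 * n)) (allFin (3 * n))) ⟩
    filterᵇ isEdge (cartesianProduct (map coord (allFin (3 * n))) (map coord (allFin (3 * n))))
      ≡⟨ cong (λ vs → filterᵇ isEdge (cartesianProduct vs vs)) coord-allFin ⟩
    filterᵇ isEdge (cartesianProduct vertices vertices)
      ≡⟨ filterᵇ-cartesianProduct isEdge vertices vertices ⟩
    concatMap edgesFrom (row 0 ++ (row 1 ++ (row 2 ++ [])))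
      ≡⟨ concatMap-++ edgesFrom (row 0) _ ⟩
    concatMap edgesFrom (row 0) ++ concatMap edgesFrom (row 1 ++ (row 2 ++ []))
      ≡⟨ cong₂ _++_ centre-rows (trans (concatMap-++ edgesFrom (row 1) _)
                                      (cong₂ _++_ (leaf-rows 0)
                                                  (trans (cong (concatMap edgesFrom) (++-identityʳ (row 2))) (leaf-rows 1)))) ⟩
    edgeList ++ []
      ≡⟨ ++-identityʳ edgeList ⟩
    edgeList ∎
    where
    open ≡-Reasoning
    pairs : List (Fin (3 * n) × Fin (3 * n))
    pairs = cartesianProduct (allFin (3 * n)) (allFin (3 * n))
    centre-rows : concatMap edgesFrom (row 0) ≡ edgeList
    centre-rows = trans (concatMap-map edgesFrom (at 0) (range 0 n))
      (concatMap-congᴬ (All.map (λ {y} (_ , y<n) → edgesFrom-centre y y<n) (range-bounded 0 n)))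
    leaf-rows : ∀ c → concatMap edgesFrom (row (suc c)) ≡ []
    leaf-rows c = trans (concatMap-map edgesFrom (at (suc c)) (range 0 n)) (concatMap-[] (edgesFrom-leaf c) (range 0 n))

  does-≟≡coord-≡ᶜ : ∀ i j → does (i Fin.≟ j) ≡ (coord i ≡ᶜ coord j)
  does-≟≡coord-≡ᶜ i j with i Fin.≟ j
  ... | yes refl = sym (≡ᶜ-refl (coord i))
  ... | no i≢j with coord i ≡ᶜ coord j in e
  ...   | true = ⊥-elim (i≢j (coord-injective (≡ᶜ⇒≡ _ _ (subst T (sym e) tt))))
  ...   | false = refl

  vsum : (ℕ → ℕ) → Coord → ℕ
  vsum w u = incidenceSum w u edgeList 0

  vertexSum≡vsum : ∀ (f : Labeling G) (w : ℕ → ℕ) → (∀ k → label G f k ≡ w (toℕ k)) →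
                   ∀ v → vertexSum G f v ≡ vsum w (coord v)
  vertexSum≡vsum f w label≡w v = begin
    vertexSum G f v
      ≡⟨ sum-map-filterᵇ-tabulate (λ k → k) (incident G v) (label G f) ⟩
    sum (tabulate (λ k → if incident G v k then label G f k else 0))
      ≡⟨ cong sum (tabulate-cong summand) ⟩
    sum (tabulate (λ k → H (lookup (edges G) k) (0 + toℕ k)))
      ≡⟨ sum-tabulate-lookup H (edges G) 0 ⟩
    indexedSum H (edges G) 0
      ≡⟨ sym (indexedSum-map _ coord² (edges G) 0) ⟩
    incidenceSum w (coord v) (map coord² (edges G)) 0
      ≡⟨ cong (λ es → incidenceSum w (coord v) es 0) coord-edges ⟩
    vsum w (coord v) ∎
    where
    open ≡-Reasoning
    H : Fin (3 * n) × Fin (3 * n) → ℕ → ℕ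
    H e k = if incidentᶜ (coord v) (coord² e) then w k else 0
    summand : ∀ k → (if incident G v k then label G f k else 0) ≡ H (lookup (edges G) k) (toℕ k)
    summand k rewrite does-≟≡coord-≡ᶜ v (proj₁ (lookup (edges G) k)) | does-≟≡coord-≡ᶜ v (proj₂ (lookup (edges G) k))
                    | label≡w k = refl

  offset : ℕ → ℕ
  offset y = length (concatMap block (range 0 y))

  blockSum : (ℕ → ℕ) → Coord → ℕ → ℕ
  blockSum w u y = incidenceSum w u (block y) (offset y)

  incidenceSum-blocks : ∀ w u r → incidenceSum w u (concatMap block (range 0 r)) 0 ≡ sumBelow r (blockSum w u)
  incidenceSum-blocks w u zero = refl
  incidenceSum-blocks w u (suc r) = begin
    incidenceSum w u (concatMap block (range 0 (suc r))) 0
      ≡⟨ cong (λ ys → incidenceSum w u (concatMap block ys) 0) (range-∷ʳ 0 r) ⟩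
    incidenceSum w u (concatMap block (range 0 r ++ [ r ])) 0
      ≡⟨ cong (λ es → incidenceSum w u es 0)
              (trans (concatMap-++ block (range 0 r) [ r ]) (cong (concatMap block (range 0 r) ++_) (++-identityʳ (block r)))) ⟩
    incidenceSum w u (concatMap block (range 0 r) ++ block r) 0
      ≡⟨ indexedSum-++ _ (concatMap block (range 0 r)) (block r) 0 ⟩
    incidenceSum w u (concatMap block (range 0 r)) 0 + blockSum w u r
      ≡⟨ cong (_+ blockSum w u r) (incidenceSum-blocks w u r) ⟩
    sumBelow (suc r) (blockSum w u) ∎
    where open ≡-Reasoning

  All-block : ∀ {P : Coord × Coord → Set} y → (∀ c t → T (pathAdj y t) → P ((0 , y) , (suc c , t))) → All P (block y)
  All-block y h = map⁺ (++⁺ (map⁺ (All.map (h 0 _) nbrs)) (map⁺ (All.map (h 1 _) nbrs)))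
    where
    nbrs : All (T ∘ pathAdj y) (neighbours y)
    nbrs = all-filter (T? ∘ pathAdj y) (range 0 n)

  blockSum-otherCentre : ∀ w {y₀ y} → y ≢ y₀ → blockSum w (0 , y₀) y ≡ 0
  blockSum-otherCentre w {y₀} {y} y≢y₀ =
    incidenceSum-zero w (0 , y₀) _ (All-block y λ _ _ _ → trans (∨-identityʳ _) (≢⇒≡ᵇ≡false (y≢y₀ ∘ sym)))

  blockSum-farLeaf : ∀ w {c t y} → suc y ≢ t → suc t ≢ y → blockSum w (suc c , t) y ≡ 0
  blockSum-farLeaf w {c} {t} {y} n₁ n₂ = incidenceSum-zero w (suc c , t) _ (All-block y λ d t′ adj →
    trans (cong ((c ≡ᵇ d) ∧_) (≢⇒≡ᵇ≡false (t≢t′ adj))) (∧-zeroʳ _))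
    where
    t≢t′ : ∀ {t′} → T (pathAdj y t′) → t ≢ t′
    t≢t′ adj refl = either n₁ n₂ (T-pathAdj adj)

  vsum-centre-block : ∀ w {y} → y < n → vsum w (0 , y) ≡ blockSum w (0 , y) y
  vsum-centre-block w {y} y<n =
    trans (incidenceSum-blocks w (0 , y) n) (sumBelow-one n y _ y<n (λ j _ j≢y → blockSum-otherCentre w j≢y))

  vsum-leaf-first-block : ∀ w c → 1 < n → vsum w (suc c , 0) ≡ blockSum w (suc c , 0) 1
  vsum-leaf-first-block w c 1<n =
    trans (incidenceSum-blocks w (suc c , 0) n) (sumBelow-one n 1 _ 1<n (λ j _ j≢1 → blockSum-farLeaf w {c} (λ ()) (j≢1 ∘ sym)))

  vsum-leaf-inner-blocks : ∀ w c t → suc (suc t) < n →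
    vsum w (suc c , suc t) ≡ blockSum w (suc c , suc t) t + blockSum w (suc c , suc t) (suc (suc t))
  vsum-leaf-inner-blocks w c t t+2<n = trans (incidenceSum-blocks w (suc c , suc t) n)
    (sumBelow-two n t (suc (suc t)) _ (n<2+n t) t+2<n
      (λ j _ j≢t j≢t+2 → blockSum-farLeaf w {c} (j≢t ∘ suc-injective) (j≢t+2 ∘ sym)))

  vsum-leaf-last-block : ∀ w c t → n ≡ suc (suc t) → vsum w (suc c , suc t) ≡ blockSum w (suc c , suc t) t
  vsum-leaf-last-block w c t refl = trans (incidenceSum-blocks w (suc c , suc t) n)
    (sumBelow-one n t _ (n<2+n t)
      (λ j j<n j≢t → blockSum-farLeaf w {c} (j≢t ∘ suc-injective) (λ { refl → <-irrefl refl j<n })))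

-- The edge list for n = p + 2

module Layout (p : ℕ) where

  open StarPath (suc (suc p)) public

  neighbours-first : neighbours 0 ≡ [ 1 ]
  neighbours-first = cong (1 ∷_) (filterᵇ-pathAdj-above 0 2 p ≤-refl)

  neighbours-middle : ∀ {j} → j < p → neighbours (suc j) ≡ j ∷ [ suc (suc j) ]
  neighbours-middle {j} j<p with m≤n⇒∃[o]m+o≡n j<p
  ... | r , refl = begin
    filterᵇ (pathAdj (suc j)) (range 0 (suc (suc (suc j + r))))
      ≡⟨ cong (filterᵇ (pathAdj (suc j))) (trans (cong (range 0) split) (range-++ 0 j (3 + r))) ⟩
    filterᵇ (pathAdj (suc j)) (range 0 j ++ j ∷ suc j ∷ suc (suc j) ∷ range (3 + j) r)
      ≡⟨ filter-++ P? (range 0 j) _ ⟩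
    filterᵇ (pathAdj (suc j)) (range 0 j) ++ filter P? (j ∷ suc j ∷ suc (suc j) ∷ range (3 + j) r)
      ≡⟨ cong (_++ filter P? (j ∷ suc j ∷ suc (suc j) ∷ range (3 + j) r)) (filterᵇ-pathAdj-below (suc j) 0 j ≤-refl) ⟩
    filter P? (j ∷ suc j ∷ suc (suc j) ∷ range (3 + j) r)
      ≡⟨ filter-accept P? {xs = suc j ∷ suc (suc j) ∷ range (3 + j) r} (pathAdj-pred j) ⟩
    j ∷ filter P? (suc j ∷ suc (suc j) ∷ range (3 + j) r)
      ≡⟨ cong (j ∷_) (filter-reject P? {x = suc j} {xs = suc (suc j) ∷ range (3 + j) r}
                                      (¬pathAdj {suc j} {suc j} 1+n≢n 1+n≢n)) ⟩
    j ∷ filter P? (suc (suc j) ∷ range (3 + j) r)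
      ≡⟨ cong (j ∷_) (filter-accept P? {xs = range (3 + j) r} (pathAdj-suc (suc j))) ⟩
    j ∷ suc (suc j) ∷ filter P? (range (3 + j) r)
      ≡⟨ cong (λ ts → j ∷ suc (suc j) ∷ ts) (filterᵇ-pathAdj-above (suc j) (3 + j) r ≤-refl) ⟩
    j ∷ [ suc (suc j) ] ∎
    where
    open ≡-Reasoning
    P? : ∀ t → Dec (T (pathAdj (suc j) t))
    P? = T? ∘ pathAdj (suc j)
    split : suc (suc (suc j + r)) ≡ j + (3 + r)
    split = sym (trans (+-suc j (2 + r)) (cong suc (trans (+-suc j (1 + r)) (cong suc (+-suc j r)))))

  neighbours-last : neighbours (suc p) ≡ [ p ]
  neighbours-last = begin
    filterᵇ (pathAdj (suc p)) (range 0 (suc (suc p)))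
      ≡⟨ cong (filterᵇ (pathAdj (suc p))) (trans (cong (range 0) (+-comm 2 p)) (range-++ 0 p 2)) ⟩
    filterᵇ (pathAdj (suc p)) (range 0 p ++ p ∷ suc p ∷ [])
      ≡⟨ filter-++ P? (range 0 p) _ ⟩
    filterᵇ (pathAdj (suc p)) (range 0 p) ++ filter P? (p ∷ suc p ∷ [])
      ≡⟨ cong (_++ filter P? (p ∷ suc p ∷ [])) (filterᵇ-pathAdj-below (suc p) 0 p ≤-refl) ⟩
    filter P? (p ∷ suc p ∷ [])
      ≡⟨ filter-accept P? {xs = suc p ∷ []} (pathAdj-pred p) ⟩
    p ∷ filter P? (suc p ∷ [])
      ≡⟨ cong (p ∷_) (filter-reject P? {x = suc p} {xs = []} (¬pathAdj {suc p} {suc p} 1+n≢n 1+n≢n)) ⟩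
    [ p ] ∎
    where
    open ≡-Reasoning
    P? : ∀ t → Dec (T (pathAdj (suc p) t))
    P? = T? ∘ pathAdj (suc p)

  firstBlock : List (Coord × Coord)
  firstBlock = ((0 , 0) , (1 , 1)) ∷ ((0 , 0) , (2 , 1)) ∷ []

  middleBlock : ℕ → List (Coord × Coord)
  middleBlock j =
    ((0 , suc j) , (1 , j)) ∷ ((0 , suc j) , (1 , suc (suc j))) ∷ ((0 , suc j) , (2 , j)) ∷ ((0 , suc j) , (2 , suc (suc j))) ∷ []

  lastBlock : List (Coord × Coord)
  lastBlock = ((0 , suc p) , (1 , p)) ∷ ((0 , suc p) , (2 , p)) ∷ []

  block-first : block 0 ≡ firstBlock
  block-first = cong (λ ns → map (from (0 , 0)) (map (at 1) ns ++ map (at 2) ns)) neighbours-first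

  block-middle : ∀ {j} → j < p → block (suc j) ≡ middleBlock j
  block-middle {j} j<p = cong (λ ns → map (from (0 , suc j)) (map (at 1) ns ++ map (at 2) ns)) (neighbours-middle j<p)

  block-last : block (suc p) ≡ lastBlock
  block-last = cong (λ ns → map (from (0 , suc p)) (map (at 1) ns ++ map (at 2) ns)) neighbours-last

  offset-suc : ∀ y → offset (suc y) ≡ offset y + length (block y)
  offset-suc y = begin
    length (concatMap block (range 0 (suc y)))            ≡⟨ cong (length ∘ concatMap block) (range-∷ʳ 0 y) ⟩
    length (concatMap block (range 0 y ++ [ y ]))         ≡⟨ cong length (concatMap-++ block (range 0 y) [ y ]) ⟩
    length (concatMap block (range 0 y) ++ block y ++ []) ≡⟨ length-++ (concatMap block (range 0 y)) ⟩
    offset y + length (block y ++ [])                     ≡⟨ cong (λ bs → offset y + length bs) (++-identityʳ (block y)) ⟩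
    offset y + length (block y)                           ∎
    where open ≡-Reasoning

  offset-middle : ∀ j → j ≤ p → offset (suc j) ≡ 2 + 4 * j
  offset-middle zero _ = trans (offset-suc 0) (cong length block-first)
  offset-middle (suc j) j<p = begin
    offset (suc (suc j))                    ≡⟨ offset-suc (suc j) ⟩
    offset (suc j) + length (block (suc j)) ≡⟨ cong₂ _+_ (offset-middle j (<⇒≤ j<p)) (cong length (block-middle j<p)) ⟩
    2 + 4 * j + 4                           ≡⟨ cong (2 +_) (trans (+-comm (4 * j) 4) (sym (*-suc 4 j))) ⟩
    2 + 4 * suc j                           ∎
    where open ≡-Reasoning

  blockSum-first : ∀ w u → blockSum w u 0 ≡ incidenceSum w u firstBlock 0
  blockSum-first w u = cong (λ es → incidenceSum w u es 0) block-first

  blockSum-middle : ∀ w u {j} → j < p → blockSum w u (suc j) ≡ incidenceSum w u (middleBlock j) (2 + 4 * j)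
  blockSum-middle w u j<p = cong₂ (incidenceSum w u) (block-middle j<p) (offset-middle _ (<⇒≤ j<p))

  blockSum-last : ∀ w u → blockSum w u (suc p) ≡ incidenceSum w u lastBlock (2 + 4 * p)
  blockSum-last w u = cong₂ (incidenceSum w u) block-last (offset-middle p ≤-refl)

  middleBlock-centre : ∀ w j o → incidenceSum w (0 , suc j) (middleBlock j) o ≡ w o + (w (1 + o) + (w (2 + o) + w (3 + o)))
  middleBlock-centre w j o rewrite ≡ᵇ-refl j = cong (λ x → w o + (w (1 + o) + (w (2 + o) + x))) (+-identityʳ _)

  middleBlock-leaf₁-left : ∀ w j o → incidenceSum w (1 , j) (middleBlock j) o ≡ w o
  middleBlock-leaf₁-left w j o rewrite ≡ᵇ-refl j | n≡ᵇ2+n j = +-identityʳ _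

  middleBlock-leaf₁-right : ∀ w j o → incidenceSum w (1 , suc (suc j)) (middleBlock j) o ≡ w (1 + o)
  middleBlock-leaf₁-right w j o rewrite ≡ᵇ-refl j | 2+n≡ᵇn j = +-identityʳ _

  middleBlock-leaf₂-left : ∀ w j o → incidenceSum w (2 , j) (middleBlock j) o ≡ w (2 + o)
  middleBlock-leaf₂-left w j o rewrite ≡ᵇ-refl j | n≡ᵇ2+n j = +-identityʳ _

  middleBlock-leaf₂-right : ∀ w j o → incidenceSum w (2 , suc (suc j)) (middleBlock j) o ≡ w (3 + o)
  middleBlock-leaf₂-right w j o rewrite ≡ᵇ-refl j | 2+n≡ᵇn j = +-identityʳ _

  lastBlock-centre : ∀ w o → incidenceSum w (0 , suc p) lastBlock o ≡ w o + w (1 + o)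
  lastBlock-centre w o rewrite ≡ᵇ-refl p = cong (w o +_) (+-identityʳ _)

  lastBlock-leaf₁ : ∀ w o → incidenceSum w (1 , p) lastBlock o ≡ w o
  lastBlock-leaf₁ w o rewrite ≡ᵇ-refl p = +-identityʳ _

  lastBlock-leaf₂ : ∀ w o → incidenceSum w (2 , p) lastBlock o ≡ w (1 + o)
  lastBlock-leaf₂ w o rewrite ≡ᵇ-refl p = +-identityʳ _

  vsum-centre-first : ∀ w → vsum w (0 , 0) ≡ w 0 + w 1
  vsum-centre-first w = trans (vsum-centre-block w z<s) (trans (blockSum-first w (0 , 0)) (cong (w 0 +_) (+-identityʳ (w 1))))

  vsum-centre-middle : ∀ w {j} → j < p → vsum w (0 , suc j) ≡ w (2 + 4 * j) + (w (3 + 4 * j) + (w (4 + 4 * j) + w (5 + 4 * j)))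
  vsum-centre-middle w {j} j<p = trans (vsum-centre-block w (s≤s (s≤s (<⇒≤ j<p))))
    (trans (blockSum-middle w (0 , suc j) j<p) (middleBlock-centre w j (2 + 4 * j)))

  vsum-centre-last : ∀ w → vsum w (0 , suc p) ≡ w (2 + 4 * p) + w (3 + 4 * p)
  vsum-centre-last w = trans (vsum-centre-block w ≤-refl) (trans (blockSum-last w (0 , suc p)) (lastBlock-centre w (2 + 4 * p)))

  vsum-leaf₁-first : ∀ w → 0 < p → vsum w (1 , 0) ≡ w 2
  vsum-leaf₁-first w 0<p =
    trans (vsum-leaf-first-block w 0 (s≤s (s≤s z≤n))) (trans (blockSum-middle w (1 , 0) 0<p) (middleBlock-leaf₁-left w 0 2))

  vsum-leaf₂-first : ∀ w → 0 < p → vsum w (2 , 0) ≡ w 4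
  vsum-leaf₂-first w 0<p =
    trans (vsum-leaf-first-block w 1 (s≤s (s≤s z≤n))) (trans (blockSum-middle w (2 , 0) 0<p) (middleBlock-leaf₂-left w 0 2))

  vsum-leaf₁-second : ∀ w → 1 < p → vsum w (1 , 1) ≡ w 0 + w 6
  vsum-leaf₁-second w 1<p = trans (vsum-leaf-inner-blocks w 0 0 (s≤s (s≤s (<⇒≤ 1<p))))
    (cong₂ _+_ (trans (blockSum-first w (1 , 1)) (+-identityʳ (w 0)))
               (trans (blockSum-middle w (1 , 1) 1<p) (middleBlock-leaf₁-left w 1 6)))

  vsum-leaf₂-second : ∀ w → 1 < p → vsum w (2 , 1) ≡ w 1 + w 8
  vsum-leaf₂-second w 1<p = trans (vsum-leaf-inner-blocks w 1 0 (s≤s (s≤s (<⇒≤ 1<p))))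
    (cong₂ _+_ (trans (blockSum-first w (2 , 1)) (+-identityʳ (w 1)))
               (trans (blockSum-middle w (2 , 1) 1<p) (middleBlock-leaf₂-left w 1 6)))

  vsum-leaf₁-inner : ∀ w {j} → 2 + j ≤ p → vsum w (1 , 2 + j) ≡ w (3 + 4 * j) + w (2 + 4 * (2 + j))
  vsum-leaf₁-inner w {j} j+2≤p = trans (vsum-leaf-inner-blocks w 0 (suc j) (s≤s (s≤s j+2≤p)))
    (cong₂ _+_ (trans (blockSum-middle w (1 , 2 + j) (<-trans (n<1+n j) j+2≤p)) (middleBlock-leaf₁-right w j (2 + 4 * j)))
               (right (m≤n⇒m<n∨m≡n j+2≤p)))
    where
    right : 2 + j < p ⊎ 2 + j ≡ p → blockSum w (1 , 2 + j) (3 + j) ≡ w (2 + 4 * (2 + j))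
    right (inj₁ j+2<p) = trans (blockSum-middle w (1 , 2 + j) j+2<p) (middleBlock-leaf₁-left w (2 + j) _)
    right (inj₂ refl) = trans (blockSum-last w (1 , 2 + j)) (lastBlock-leaf₁ w _)

  vsum-leaf₂-inner : ∀ w {j} → 2 + j < p → vsum w (2 , 2 + j) ≡ w (5 + 4 * j) + w (4 + 4 * (2 + j))
  vsum-leaf₂-inner w {j} j+2<p = trans (vsum-leaf-inner-blocks w 1 (suc j) (s≤s (s≤s (<⇒≤ j+2<p))))
    (cong₂ _+_ (trans (blockSum-middle w (2 , 2 + j) (<-trans (n<2+n j) j+2<p)) (middleBlock-leaf₂-right w j (2 + 4 * j)))
               (trans (blockSum-middle w (2 , 2 + j) j+2<p) (middleBlock-leaf₂-left w (2 + j) _)))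

  vsum-leaf₂-penultimate : ∀ w {j} → p ≡ 2 + j → vsum w (2 , p) ≡ w (5 + 4 * j) + w (3 + 4 * p)
  vsum-leaf₂-penultimate w {j} refl = trans (vsum-leaf-inner-blocks w 1 (suc j) ≤-refl)
    (cong₂ _+_ (trans (blockSum-middle w (2 , 2 + j) (n<2+n j)) (middleBlock-leaf₂-right w j (2 + 4 * j)))
               (trans (blockSum-last w (2 , 2 + j)) (lastBlock-leaf₂ w _)))

  vsum-leaf₁-last : ∀ w {q} → p ≡ suc q → vsum w (1 , suc p) ≡ w (3 + 4 * q)
  vsum-leaf₁-last w {q} refl =
    trans (vsum-leaf-last-block w 0 p refl) (trans (blockSum-middle w (1 , suc p) ≤-refl) (middleBlock-leaf₁-right w q _))

  vsum-leaf₂-last : ∀ w {q} → p ≡ suc q → vsum w (2 , suc p) ≡ w (5 + 4 * q)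
  vsum-leaf₂-last w {q} refl =
    trans (vsum-leaf-last-block w 1 p refl) (trans (blockSum-middle w (2 , suc p) ≤-refl) (middleBlock-leaf₂-right w q _))

-- The labelling

swap : ℕ → ℕ → ℕ → ℕ
swap a b k = if k ≡ᵇ a then b else if k ≡ᵇ b then a else k

swap-left : ∀ a b → swap a b a ≡ b
swap-left a b rewrite ≡ᵇ-refl a = refl

swap-right : ∀ {a b} → b ≢ a → swap a b b ≡ a
swap-right {a} {b} b≢a rewrite ≢⇒≡ᵇ≡false b≢a | ≡ᵇ-refl b = refl

swap-fixed : ∀ {a b k} → k ≢ a → k ≢ b → swap a b k ≡ k
swap-fixed k≢a k≢b rewrite ≢⇒≡ᵇ≡false k≢a | ≢⇒≡ᵇ≡false k≢b = refl

toℕ-transpose : ∀ {n} (i j k : Fin n) → toℕ (PC.transpose i j k) ≡ swap (toℕ i) (toℕ j) (toℕ k)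
toℕ-transpose i j k with k Fin.≟ i
... | yes refl = sym (swap-left (toℕ k) (toℕ j))
... | no k≢i with k Fin.≟ j
...   | yes refl = sym (swap-right (k≢i ∘ toℕ-injective))
...   | no k≢j = sym (swap-fixed (k≢i ∘ toℕ-injective) (k≢j ∘ toℕ-injective))

[x+4a]%4≡x%4 : ∀ x a → (x + 4 * a) % 4 ≡ x % 4
[x+4a]%4≡x%4 x a = trans (cong (λ y → (x + y) % 4) (*-comm 4 a)) ([m+kn]%n≡m%n x a 4)

≢-by-%4 : ∀ x y a b → x % 4 ≢ y % 4 → x + 4 * a ≢ y + 4 * b
≢-by-%4 x y a b x≢y e = x≢y (trans (sym ([x+4a]%4≡x%4 x a)) (trans (cong (_% 4) e) ([x+4a]%4≡x%4 y b)))

module Labelling (p : ℕ) (0<p : 0 < p) where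

  open Layout p public

  size≡ : size G ≡ 4 + 4 * p
  size≡ = begin
    length (edges G)                        ≡⟨ sym (length-map coord² (edges G)) ⟩
    length (map coord² (edges G))           ≡⟨ cong length coord-edges ⟩
    offset (suc (suc p))                    ≡⟨ offset-suc (suc p) ⟩
    offset (suc p) + length (block (suc p)) ≡⟨ cong₂ _+_ (offset-middle p ≤-refl) (cong length block-last) ⟩
    2 + 4 * p + 2                           ≡⟨ cong (2 +_) (+-comm (4 * p) 2) ⟩
    4 + 4 * p                               ∎
    where open ≡-Reasoning

  edge : ∀ k → k < 4 + 4 * p → Fin (size G)
  edge k k<size = fromℕ< (subst (k <_) (sym size≡) k<size)

  e₂ e₆ e₁₊₄ₚ e₃₊₄ₚ : Fin (size G)
  e₂ = edge 2 (s≤s (s≤s (s≤s z≤n)))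
  e₆ = edge 6 (≤-trans (s≤s (s≤s (s≤s (s≤s (s≤s (s≤s (s≤s z≤n))))))) (+-monoʳ-≤ 4 (*-monoʳ-≤ 4 0<p)))
  e₁₊₄ₚ = edge (1 + 4 * p) (s≤s (s≤s (m≤n+m (4 * p) 2)))
  e₃₊₄ₚ = edge (3 + 4 * p) ≤-refl

  labelling : Labeling G
  labelling = ↔⇒⤖ (transpose e₂ e₆ ∘ₚ transpose e₁₊₄ₚ e₃₊₄ₚ)

  σ : ℕ → ℕ
  σ k = swap (1 + 4 * p) (3 + 4 * p) (swap 2 6 k)

  label-labelling : ∀ k → label G labelling k ≡ suc (σ (toℕ k))
  label-labelling k = cong suc (begin
    toℕ (PC.transpose e₁₊₄ₚ e₃₊₄ₚ (PC.transpose e₂ e₆ k))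
      ≡⟨ toℕ-transpose e₁₊₄ₚ e₃₊₄ₚ (PC.transpose e₂ e₆ k) ⟩
    swap (toℕ e₁₊₄ₚ) (toℕ e₃₊₄ₚ) (toℕ (PC.transpose e₂ e₆ k))
      ≡⟨ cong (swap (toℕ e₁₊₄ₚ) (toℕ e₃₊₄ₚ)) (toℕ-transpose e₂ e₆ k) ⟩
    swap (toℕ e₁₊₄ₚ) (toℕ e₃₊₄ₚ) (swap (toℕ e₂) (toℕ e₆) (toℕ k))
      ≡⟨ cong₂ (λ a b → swap a b (swap (toℕ e₂) (toℕ e₆) (toℕ k))) (toℕ-fromℕ< _) (toℕ-fromℕ< _) ⟩
    swap (1 + 4 * p) (3 + 4 * p) (swap (toℕ e₂) (toℕ e₆) (toℕ k))
      ≡⟨ cong₂ (λ a b → swap (1 + 4 * p) (3 + 4 * p) (swap a b (toℕ k))) (toℕ-fromℕ< _) (toℕ-fromℕ< _) ⟩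
    σ (toℕ k) ∎)
    where open ≡-Reasoning

  σ-fixed : ∀ {k} → k ≢ 2 → k ≢ 6 → k ≢ 1 + 4 * p → k ≢ 3 + 4 * p → σ k ≡ k
  σ-fixed k≢2 k≢6 k≢1+4p k≢3+4p =
    trans (cong (swap (1 + 4 * p) (3 + 4 * p)) (swap-fixed k≢2 k≢6)) (swap-fixed k≢1+4p k≢3+4p)

  σ-2 : σ 2 ≡ 6
  σ-2 = trans (cong (swap (1 + 4 * p) (3 + 4 * p)) (swap-left 2 6))
              (swap-fixed (≢-by-%4 2 1 1 p (λ ())) (≢-by-%4 2 3 1 p (λ ())))

  σ-6 : σ 6 ≡ 2
  σ-6 = trans (cong (swap (1 + 4 * p) (3 + 4 * p)) (swap-right {2} {6} (λ ())))
              (swap-fixed (≢-by-%4 2 1 0 p (λ ())) (≢-by-%4 2 3 0 p (λ ())))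

  σ-1+4p : σ (1 + 4 * p) ≡ 3 + 4 * p
  σ-1+4p = trans (cong (swap (1 + 4 * p) (3 + 4 * p)) (swap-fixed (≢-by-%4 1 2 p 0 (λ ())) (≢-by-%4 1 2 p 1 (λ ()))))
                 (swap-left (1 + 4 * p) (3 + 4 * p))

  σ-3+4p : σ (3 + 4 * p) ≡ 1 + 4 * p
  σ-3+4p = trans (cong (swap (1 + 4 * p) (3 + 4 * p)) (swap-fixed (≢-by-%4 3 2 p 0 (λ ())) (≢-by-%4 3 2 p 1 (λ ()))))
                 (swap-right (≢-by-%4 3 1 p p (λ ())))

-- Decoding the vertex sums

[r+8q]/8≡q : ∀ r q → r < 8 → (r + 8 * q) / 8 ≡ q
[r+8q]/8≡q r q r<8 = begin
  (r + 8 * q) / 8   ≡⟨ cong (λ x → (r + x) / 8) (*-comm 8 q) ⟩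
  (r + q * 8) / 8   ≡⟨ +-distrib-/-∣ʳ r (n∣m*n q) ⟩
  r / 8 + q * 8 / 8 ≡⟨ cong₂ _+_ (m<n⇒m/n≡0 r<8) (m*n/n≡m q 8) ⟩
  q                 ∎
  where open ≡-Reasoning

[r+8q]%8≡r : ∀ r q → r < 8 → (r + 8 * q) % 8 ≡ r
[r+8q]%8≡r r q r<8 = trans (cong (λ x → (r + x) % 8) (*-comm 8 q)) (trans ([m+kn]%n≡m%n r q 8) (m<n⇒m%n≡m r<8))

digit : ∀ r {_ : T (r <ᵇ 8)} → r < 8
digit r {r<8} = <ᵇ⇒< r 8 r<8

module Large (h p : ℕ) (p≡h+h : p ≡ h + h) (2≤h : 2 ≤ h) where

  4≤p : 4 ≤ p
  4≤p = subst (4 ≤_) (sym p≡h+h) (+-mono-≤ 2≤h 2≤h)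

  0<p : 0 < p
  0<p = ≤-trans (s≤s z≤n) 4≤p

  1<p : 1 < p
  1<p = ≤-trans (s≤s (s≤s z≤n)) 4≤p

  open Labelling p 0<p public

  w : ℕ → ℕ
  w = suc ∘ σ

  -- The sums vsum w (x , y): (0 , 0) ↦ 3, (0 , 1) ↦ 22, (0 , 2) ↦ 30, (0 , j + 1) ↦ 16j + 18,
  -- (0 , p) ↦ 16p + 4, (0 , p + 1) ↦ 8p + 5, (1 , 0) ↦ 7, (1 , 1) ↦ 4, (1 , t) ↦ 8t - 1, (1 , p + 1) ↦ 4p,
  -- (2 , 0) ↦ 5, (2 , 1) ↦ 11, (2 , t) ↦ 8t + 3, (2 , p) ↦ 8p, (2 , p + 1) ↦ 4p + 4,
  -- for 2 ≤ j ≤ p - 2 and 2 ≤ t, with t ≤ p for the leaves (1 , t) and t < p for the leaves (2 , t).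
  decodeDigits : ℕ → ℕ → Coord
  decodeDigits q 0 = if q ≡ᵇ h then (1 , suc p) else (2 , p)
  decodeDigits q 2 = (0 , ⌊ q /2⌋)
  decodeDigits q 3 = if q ≡ᵇ 0 then (0 , 0) else (2 , q)
  decodeDigits q 4 = if q ≡ᵇ 0 then (1 , 1) else if q ≡ᵇ h then (2 , suc p) else (0 , p)
  decodeDigits q 5 = if q ≡ᵇ 0 then (2 , 0) else (0 , suc p)
  decodeDigits q 6 = if q ≡ᵇ 2 then (0 , 1) else (0 , 2)
  decodeDigits q 7 = if q ≡ᵇ 0 then (1 , 0) else (1 , suc q)
  decodeDigits q _ = (0 , 0)

  decode : ℕ → Coord
  decode s = decodeDigits (s / 8) (s % 8)

  decodes-to : ∀ {u} r q → r < 8 → vsum w u ≡ r + 8 * q → decodeDigits q r ≡ u → decode (vsum w u) ≡ u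
  decodes-to r q r<8 sum≡ digits =
    trans (cong decode sum≡) (trans (cong₂ decodeDigits ([r+8q]/8≡q r q r<8) ([r+8q]%8≡r r q r<8)) digits)

  16≤4p : 16 ≤ 4 * p
  16≤4p = *-monoʳ-≤ 4 4≤p

  1+4p<3+4p : 1 + 4 * p < 3 + 4 * p
  1+4p<3+4p = s≤s (s≤s (n≤1+n _))

  σ-small : ∀ k {_ : T (k ≤ᵇ 16)} → k ≢ 2 → k ≢ 6 → σ k ≡ k
  σ-small k {k≤16} k≢2 k≢6 = σ-fixed k≢2 k≢6 (<⇒≢ k<1+4p) (<⇒≢ (<-trans k<1+4p 1+4p<3+4p))
    where
    k<1+4p : k < 1 + 4 * p
    k<1+4p = s≤s (≤-trans (≤ᵇ⇒≤ k 16 k≤16) 16≤4p)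

  σ-between : ∀ {k} → 7 ≤ k → k < 1 + 4 * p → σ k ≡ k
  σ-between 7≤k k<1+4p =
    σ-fixed (>⇒≢ (≤-trans (s≤s (s≤s (s≤s z≤n))) 7≤k)) (>⇒≢ 7≤k) (<⇒≢ k<1+4p) (<⇒≢ (<-trans k<1+4p 1+4p<3+4p))

  7≤2+4j : ∀ {j} → 2 ≤ j → 7 ≤ 2 + 4 * j
  7≤2+4j 2≤j = s≤s (s≤s (≤-trans (s≤s (s≤s (s≤s (s≤s (s≤s z≤n))))) (*-monoʳ-≤ 4 2≤j)))

  5+4j<1+4p : ∀ {j} → suc j < p → 5 + 4 * j < 1 + 4 * p
  5+4j<1+4p {j} j+1<p = subst (_< 1 + 4 * p) (cong suc (*-suc 4 j)) (+-monoʳ-< 1 (*-monoʳ-< 4 j+1<p))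

  σ-5+4j : ∀ {j} → suc j < p → σ (5 + 4 * j) ≡ 5 + 4 * j
  σ-5+4j {j} j+1<p =
    σ-fixed (≢-by-%4 5 2 j 0 (λ ())) (≢-by-%4 5 2 j 1 (λ ())) (<⇒≢ (5+4j<1+4p j+1<p)) (≢-by-%4 5 3 j p (λ ()))

  p≢0 : p ≢ 0
  p≢0 = >⇒≢ 0<p

  h<p : h < p
  h<p = subst (h <_) (sym p≡h+h) (m<m+n h (≤-trans (s≤s z≤n) 2≤h))

  decodes-centre-first : decode (vsum w (0 , 0)) ≡ (0 , 0)
  decodes-centre-first = decodes-to 3 0 (digit 3)
    (trans (vsum-centre-first w) (cong₂ (λ a b → suc a + suc b) (σ-small 0 (λ ()) (λ ())) (σ-small 1 (λ ()) (λ ())))) refl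

  decodes-centre-second : decode (vsum w (0 , 1)) ≡ (0 , 1)
  decodes-centre-second = decodes-to 6 2 (digit 6)
    (trans (vsum-centre-middle w {0} 0<p) (cong₂ _+_ (cong suc σ-2) (cong₂ _+_ (cong suc (σ-small 3 (λ ()) (λ ())))
      (cong₂ _+_ (cong suc (σ-small 4 (λ ()) (λ ()))) (cong suc (σ-small 5 (λ ()) (λ ()))))))) refl

  decodes-centre-third : decode (vsum w (0 , 2)) ≡ (0 , 2)
  decodes-centre-third = decodes-to 6 3 (digit 6)
    (trans (vsum-centre-middle w {1} 1<p) (cong₂ _+_ (cong suc σ-6) (cong₂ _+_ (cong suc (σ-small 7 (λ ()) (λ ())))
      (cong₂ _+_ (cong suc (σ-small 8 (λ ()) (λ ()))) (cong suc (σ-small 9 (λ ()) (λ ()))))))) refl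

  decodes-centre-middle : ∀ {j} → 2 ≤ j → suc j < p → decode (vsum w (0 , suc j)) ≡ (0 , suc j)
  decodes-centre-middle {j} 2≤j j+1<p = decodes-to 2 (suc j + suc j) (digit 2)
    (trans (vsum-centre-middle w (<-trans (n<1+n j) j+1<p))
      (trans (cong₂ _+_ (fixed ≤-refl (m≤n+m _ 3)) (cong₂ _+_ (fixed (m≤n+m _ 1) (m≤n+m _ 2))
                 (cong₂ _+_ (fixed (m≤n+m _ 2) (m≤n+m _ 1)) (fixed (m≤n+m _ 3) ≤-refl))))
             (arith j)))
    (cong (0 ,_) (sym (n≡⌊n+n/2⌋ (suc j))))
    where
    fixed : ∀ {k} → 2 + 4 * j ≤ k → k ≤ 5 + 4 * j → w k ≡ suc k
    fixed lo hi = cong suc (σ-between (≤-trans (7≤2+4j 2≤j) lo) (≤-<-trans hi (5+4j<1+4p j+1<p)))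
    arith : ∀ j → suc (2 + 4 * j) + (suc (3 + 4 * j) + (suc (4 + 4 * j) + suc (5 + 4 * j))) ≡ 2 + 8 * (suc j + suc j)
    arith = solve-∀

  decodes-centre-penultimate : ∀ {j} → suc j ≡ p → 2 ≤ j → decode (vsum w (0 , suc j)) ≡ (0 , suc j)
  decodes-centre-penultimate {j} refl 2≤j = decodes-to 4 (suc j + suc j) (digit 4)
    (trans (vsum-centre-middle w (n<1+n j))
      (trans (cong₂ _+_ (fixed ≤-refl (m≤n+m _ 2)) (cong₂ _+_ (fixed (m≤n+m _ 1) (m≤n+m _ 1))
                 (cong₂ _+_ (fixed (m≤n+m _ 2) ≤-refl) (trans (cong w last≡) (cong suc σ-1+4p)))))
             (arith j)))
    digits
    where
    digits : decodeDigits (suc j + suc j) 4 ≡ (0 , suc j)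
    digits rewrite ≢⇒≡ᵇ≡false (>⇒≢ (<-≤-trans h<p (m≤m+n (suc j) (suc j)))) = refl
    last≡ : 5 + 4 * j ≡ 1 + 4 * suc j
    last≡ = cong suc (sym (*-suc 4 j))
    fixed : ∀ {k} → 2 + 4 * j ≤ k → k ≤ 4 + 4 * j → w k ≡ suc k
    fixed lo hi = cong suc (σ-between (≤-trans (7≤2+4j 2≤j) lo) (≤-<-trans hi (subst (4 + 4 * j <_) last≡ ≤-refl)))
    arith : ∀ j → suc (2 + 4 * j) + (suc (3 + 4 * j) + (suc (4 + 4 * j) + suc (3 + 4 * suc j))) ≡ 4 + 8 * (suc j + suc j)
    arith = solve-∀

  decodes-centre-last : decode (vsum w (0 , suc p)) ≡ (0 , suc p)
  decodes-centre-last = decodes-to 5 p (digit 5)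
    (trans (vsum-centre-last w) (trans (cong₂ _+_ (cong suc σ-2+4p) (cong suc σ-3+4p)) (arith p)))
    digits
    where
    6<2+4p : 6 < 2 + 4 * p
    6<2+4p = s≤s (s≤s (≤-trans (s≤s (s≤s (s≤s (s≤s (s≤s z≤n))))) 16≤4p))
    σ-2+4p : σ (2 + 4 * p) ≡ 2 + 4 * p
    σ-2+4p = σ-fixed (>⇒≢ (<-trans (s≤s (s≤s (s≤s z≤n))) 6<2+4p)) (>⇒≢ 6<2+4p)
                     (≢-by-%4 2 1 p p (λ ())) (≢-by-%4 2 3 p p (λ ()))
    arith : ∀ p → suc (2 + 4 * p) + suc (1 + 4 * p) ≡ 5 + 8 * p
    arith = solve-∀
    digits : decodeDigits p 5 ≡ (0 , suc p)
    digits rewrite ≢⇒≡ᵇ≡false p≢0 = refl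

  decodes-leaf₁-first : decode (vsum w (1 , 0)) ≡ (1 , 0)
  decodes-leaf₁-first = decodes-to 7 0 (digit 7) (trans (vsum-leaf₁-first w 0<p) (cong suc σ-2)) refl

  decodes-leaf₁-second : decode (vsum w (1 , 1)) ≡ (1 , 1)
  decodes-leaf₁-second = decodes-to 4 0 (digit 4)
    (trans (vsum-leaf₁-second w 1<p) (cong₂ _+_ (cong suc (σ-small 0 (λ ()) (λ ()))) (cong suc σ-6))) refl

  decodes-leaf₁-inner : ∀ {j} → 2 + j ≤ p → decode (vsum w (1 , 2 + j)) ≡ (1 , 2 + j)
  decodes-leaf₁-inner {j} j+2≤p = decodes-to 7 (suc j) (digit 7)
    (trans (vsum-leaf₁-inner w j+2≤p) (trans (cong₂ _+_ (cong suc σ-left) (cong suc σ-right)) (arith j)))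
    refl
    where
    σ-left : σ (3 + 4 * j) ≡ 3 + 4 * j
    σ-left = σ-fixed (≢-by-%4 3 2 j 0 (λ ())) (≢-by-%4 3 2 j 1 (λ ())) (≢-by-%4 3 1 j p (λ ()))
                     (<⇒≢ (+-monoʳ-< 3 (*-monoʳ-< 4 (<-trans (n<1+n j) j+2≤p))))
    σ-right : σ (2 + 4 * (2 + j)) ≡ 2 + 4 * (2 + j)
    σ-right = σ-fixed (>⇒≢ (<-trans (s≤s (s≤s (s≤s z≤n))) 7≤)) (>⇒≢ 7≤)
                      (≢-by-%4 2 1 (2 + j) p (λ ())) (≢-by-%4 2 3 (2 + j) p (λ ()))
      where
      7≤ : 7 ≤ 2 + 4 * (2 + j)
      7≤ = 7≤2+4j (m≤m+n 2 j)
    arith : ∀ j → suc (3 + 4 * j) + suc (2 + 4 * (2 + j)) ≡ 7 + 8 * suc j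
    arith = solve-∀

  decodes-leaf₁-last : ∀ {q} → suc q ≡ p → decode (vsum w (1 , suc (suc q))) ≡ (1 , suc (suc q))
  decodes-leaf₁-last {q} refl = decodes-to 0 h (digit 0)
    (trans (vsum-leaf₁-last w refl) (trans (cong suc σ-3+4q) value))
    digits
    where
    σ-3+4q : σ (3 + 4 * q) ≡ 3 + 4 * q
    σ-3+4q = σ-fixed (≢-by-%4 3 2 q 0 (λ ())) (≢-by-%4 3 2 q 1 (λ ())) (≢-by-%4 3 1 q (suc q) (λ ()))
                     (<⇒≢ (+-monoʳ-< 3 (*-monoʳ-< 4 (n<1+n q))))
    value : suc (3 + 4 * q) ≡ 0 + 8 * h
    value = begin
      suc (3 + 4 * q) ≡⟨ sym (*-suc 4 q) ⟩
      4 * suc q       ≡⟨ cong (4 *_) p≡h+h ⟩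
      4 * (h + h)     ≡⟨ arith h ⟩
      0 + 8 * h       ∎
      where
      open ≡-Reasoning
      arith : ∀ h → 4 * (h + h) ≡ 0 + 8 * h
      arith = solve-∀
    digits : decodeDigits h 0 ≡ (1 , suc (suc q))
    digits rewrite ≡ᵇ-refl h = refl

  decodes-leaf₂-first : decode (vsum w (2 , 0)) ≡ (2 , 0)
  decodes-leaf₂-first = decodes-to 5 0 (digit 5) (trans (vsum-leaf₂-first w 0<p) (cong suc (σ-small 4 (λ ()) (λ ())))) refl

  decodes-leaf₂-second : decode (vsum w (2 , 1)) ≡ (2 , 1)
  decodes-leaf₂-second = decodes-to 3 1 (digit 3)
    (trans (vsum-leaf₂-second w 1<p) (cong₂ _+_ (cong suc (σ-small 1 (λ ()) (λ ()))) (cong suc (σ-small 8 (λ ()) (λ ()))))) refl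

  decodes-leaf₂-inner : ∀ {j} → 2 + j < p → decode (vsum w (2 , 2 + j)) ≡ (2 , 2 + j)
  decodes-leaf₂-inner {j} j+2<p = decodes-to 3 (2 + j) (digit 3)
    (trans (vsum-leaf₂-inner w j+2<p) (trans (cong₂ _+_ (cong suc (σ-5+4j (<-trans (n<1+n _) j+2<p))) (cong suc σ-right)) (arith j)))
    refl
    where
    σ-right : σ (4 + 4 * (2 + j)) ≡ 4 + 4 * (2 + j)
    σ-right = σ-fixed (≢-by-%4 4 2 (2 + j) 0 (λ ())) (≢-by-%4 4 2 (2 + j) 1 (λ ()))
                      (≢-by-%4 4 1 (2 + j) p (λ ())) (≢-by-%4 4 3 (2 + j) p (λ ()))
    arith : ∀ j → suc (5 + 4 * j) + suc (4 + 4 * (2 + j)) ≡ 3 + 8 * (2 + j)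
    arith = solve-∀

  decodes-leaf₂-penultimate : ∀ {j} → 2 + j ≡ p → decode (vsum w (2 , 2 + j)) ≡ (2 , 2 + j)
  decodes-leaf₂-penultimate {j} refl = decodes-to 0 (2 + j) (digit 0)
    (trans (vsum-leaf₂-penultimate w refl) (trans (cong₂ _+_ (cong suc (σ-5+4j (n<1+n _))) (cong suc σ-3+4p)) (arith j)))
    digits
    where
    arith : ∀ j → suc (5 + 4 * j) + suc (1 + 4 * (2 + j)) ≡ 0 + 8 * (2 + j)
    arith = solve-∀
    digits : decodeDigits (2 + j) 0 ≡ (2 , 2 + j)
    digits rewrite ≢⇒≡ᵇ≡false (>⇒≢ h<p) = refl

  decodes-leaf₂-last : ∀ {q} → suc q ≡ p → decode (vsum w (2 , suc (suc q))) ≡ (2 , suc (suc q))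
  decodes-leaf₂-last {q} refl = decodes-to 4 h (digit 4)
    (trans (vsum-leaf₂-last w refl) (trans (cong w (cong suc (sym (*-suc 4 q)))) (trans (cong suc σ-1+4p) value)))
    digits
    where
    value : suc (3 + 4 * suc q) ≡ 4 + 8 * h
    value = trans (cong (λ x → 4 + 4 * x) p≡h+h) (arith h)
      where
      arith : ∀ h → 4 + 4 * (h + h) ≡ 4 + 8 * h
      arith = solve-∀
    digits : decodeDigits h 4 ≡ (2 , suc (suc q))
    digits rewrite ≢⇒≡ᵇ≡false (>⇒≢ (≤-trans (s≤s z≤n) 2≤h)) | ≡ᵇ-refl h = refl

  decodes : ∀ x y → x < 3 → y < suc (suc p) → decode (vsum w (x , y)) ≡ (x , y)
  decodes 0 0 _ _ = decodes-centre-first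
  decodes 0 1 _ _ = decodes-centre-second
  decodes 0 2 _ _ = decodes-centre-third
  decodes 0 (suc (suc (suc i))) _ y<n with <-cmp (3 + i) p
  ... | tri< y<p _ _ = decodes-centre-middle (s≤s (s≤s z≤n)) y<p
  ... | tri≈ _ y≡p _ = decodes-centre-penultimate y≡p (s≤s (s≤s z≤n))
  ... | tri> _ _ p<y rewrite ≤-antisym (≤-pred y<n) p<y = decodes-centre-last
  decodes 1 0 _ _ = decodes-leaf₁-first
  decodes 1 1 _ _ = decodes-leaf₁-second
  decodes 1 (suc (suc j)) _ y<n with m≤n⇒m<n∨m≡n (≤-pred y<n)
  ... | inj₁ y≤p = decodes-leaf₁-inner (≤-pred y≤p)
  ... | inj₂ y≡p+1 = decodes-leaf₁-last (suc-injective y≡p+1)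
  decodes 2 0 _ _ = decodes-leaf₂-first
  decodes 2 1 _ _ = decodes-leaf₂-second
  decodes 2 (suc (suc j)) _ y<n with <-cmp (2 + j) p
  ... | tri< y<p _ _ = decodes-leaf₂-inner y<p
  ... | tri≈ _ y≡p _ = decodes-leaf₂-penultimate y≡p
  ... | tri> _ _ p<y = decodes-leaf₂-last (suc-injective (≤-antisym (≤-pred y<n) p<y))
  decodes (suc (suc (suc x))) y (s≤s (s≤s (s≤s ()))) _

  antimagic : Antimagic G
  antimagic = labelling , λ {v} {v′} eq → coord-injective (trans (sym (decodes-coord v)) (trans (cong decode eq) (decodes-coord v′)))
    where
    decodes-coord : ∀ v → decode (vertexSum G labelling v) ≡ coord v
    decodes-coord v = trans (cong decode (vertexSum≡vsum labelling w label-labelling v))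
      (decodes (proj₁ (coord v)) (proj₂ (coord v)) (toℕ<n _) (toℕ<n _))

-- For p = 2 the families of the decoder overlap ((0 , 2) is also (0 , p)), so the sums are computed.
module Smallest where

  open Labelling 2 (s≤s z≤n)

  sums : List ℕ
  sums = 3 ∷ 22 ∷ 32 ∷ 21 ∷ 7 ∷ 4 ∷ 15 ∷ 8 ∷ 5 ∷ 11 ∷ 16 ∷ 12 ∷ []

  vertexSum≡sums : ∀ v → vertexSum G labelling v ≡ lookup sums v
  vertexSum≡sums = toWitness {a? = all? λ v → vertexSum G labelling v ≟ lookup sums v} tt

  sums-injective : Injective _≡_ _≡_ (lookup sums)
  sums-injective {i} {j} = toWitness {a? = all? λ i → all? λ j → (lookup sums i ≟ lookup sums j) →-dec (i Fin.≟ j)} tt i j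

  antimagic : Antimagic G
  antimagic = labelling , λ {v} {v′} eq → sums-injective (trans (sym (vertexSum≡sums v)) (trans eq (vertexSum≡sums v′)))

lemma2p2 : (m : ℕ) → Antimagic (directProduct (star 2) (path (2 * suc m + 2)))
lemma2p2 zero = Smallest.antimagic
lemma2p2 (suc m) =
  subst (λ n → Antimagic (directProduct (star 2) (path n))) (length≡ m) (Large.antimagic h (h + h) refl (s≤s (s≤s z≤n)))
  where
  h : ℕ
  h = suc (suc m)
  length≡ : ∀ m → suc (suc (suc (suc m) + suc (suc m))) ≡ 2 * suc (suc m) + 2
  length≡ = solve-∀
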